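{- Let $G \in ER(n,d,4)$ have a uniform shared neighborhood structure. Then this uniform shared neighborhood structure is not isomorphic to the path $P_4$.
   Context: For a finite simple graph $G$, $N(u)$ is the open neighborhood of a vertex $u$. $G \in ER(n,d,\lambda)$ means $G$ has $n$ vertices, is $d$-regular, and every pair of adjacent vertices has exactly $\lambda$ common neighbors. $G$ has a uniform shared neighborhood structure isomorphic to $H$ if the induced subgraph $G[N(u)\cap N(v)]$ is isomorphic to $H$ for all adjacent $u,v$. $P_m$ is the path graph on $m$ vertices. -}

module Defs where

open import Data.Nat using (ℕ; suc)
open import Data.Bool using (Bool; true; false)
open import Data.Fin using (Fin; toℕ)
open import Data.Product using (Σ; _×_; proj₁)
open import Relation.Binary.PropositionalEquality using (_≡_)
import Relation.Binary.PropositionalEquality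
open import Relation.Nullary using (¬_)
open import Function.Bundles using (_⤖_; _⇔_; Bijection)

record Graph (n : ℕ) : Set where
  field
    adj     : Fin n → Fin n → Bool
    sym     : ∀ u v → adj u v ≡ adj v u
    irrefl  : ∀ u → adj u u ≡ false
open Graph public

Adj : ∀ {n} → Graph n → Fin n → Fin n → Set
Adj G u v = adj G u v ≡ true

N : ∀ {n} → Graph n → Fin n → Set
N G u = Σ (Fin _) λ w → Adj G u w

Common : ∀ {n} → Graph n → Fin n → Fin n → Set
Common G u v = Σ (Fin _) λ w → Adj G u w × Adj G v w

Regular : ∀ {n} → Graph n → ℕ → Set
Regular G d = ∀ u → N G u ⤖ Fin d

ER : (n d λ' : ℕ) → Graph n → Set
ER n d λ' G = Regular G d × (∀ u v → Adj G u v → Common G u v ⤖ Fin λ')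

CommonIsoTo : ∀ {n m} → Graph n → Fin n → Fin n → Graph m → Set
CommonIsoTo G u v H =
  Σ (Common G u v ⤖ Fin _) λ f →
    ∀ x y → Adj G (proj₁ x) (proj₁ y) ⇔ Adj H (Bijection.to f x) (Bijection.to f y)

UniformSNS : ∀ {n m} → Graph n → Graph m → Set
UniformSNS G H = ∀ u v → Adj G u v → CommonIsoTo G u v H

Iso : ∀ {m} → Graph m → Graph m → Set
Iso {m} H K = Σ (Fin m ⤖ Fin m) λ f →
  ∀ x y → Adj H x y ⇔ Adj K (Bijection.to f x) (Bijection.to f y)

P : (m : ℕ) → Graph m
P m = record { adj = pathAdj ; sym = pathSym ; irrefl = pathIrr }
  where
  open import Data.Nat using (_≡ᵇ_)
  open import Data.Bool using (_∨_)
  open import Data.Bool.Properties using (∨-comm)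
  pathAdj : Fin m → Fin m → Bool
  pathAdj i j = (suc (toℕ i) ≡ᵇ toℕ j) ∨ (suc (toℕ j) ≡ᵇ toℕ i)
  pathSym : ∀ u v → pathAdj u v ≡ pathAdj v u
  pathSym u v = ∨-comm (suc (toℕ u) ≡ᵇ toℕ v) _
  pathIrr : ∀ u → pathAdj u u ≡ false
  pathIrr u = lem (toℕ u)
    where
    lem : ∀ k → ((suc k ≡ᵇ k) ∨ (suc k ≡ᵇ k)) ≡ false
    lem 0 = Relation.Binary.PropositionalEquality.refl
    lem (suc k) = lem k

{-# OPTIONS --safe #-}
-- If every common neighbourhood induces P₄, take an edge uv and an end a of the path
-- G[N(u) ∩ N(v)], with neighbour b and next vertex c.  In G[N(u) ∩ N(a)] the vertex v
-- is pendant at b, since N(u) ∩ N(v) ∩ N(a) = {b}; so b has a second neighbour y there.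
-- Then c – v – a – y is a path in G[N(u) ∩ N(b)], hence all of it, and c is pendant at v:
-- N(u) ∩ N(b) ∩ N(c) = {v}.  By symmetry N(v) ∩ N(b) ∩ N(c) = {u}, so uv is an
-- isolated edge of G[N(b) ∩ N(c)] ≅ P₄, which is absurd.
module Submission where

open import Defs
open import Level using (0ℓ)
open import Data.Nat using (ℕ)
open import Data.Fin using (Fin)
open import Data.Fin.Properties using (all?; any?) renaming (_≟_ to _≟ᶠ_)
open import Data.Bool using (true)
open import Data.Bool.Properties using () renaming (_≟_ to _≟ᵇ_)
open import Data.Empty using (⊥)
open import Data.Product using (Σ; ∃; ∃-syntax; _×_; _,_; proj₁; proj₂; map₂; swap)
open import Relation.Binary.Core using (Rel)
open import Relation.Binary.Definitions using (Decidable)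
open import Relation.Nullary using (¬_; ¬?)
open import Relation.Nullary.Decidable using (_×-dec_; _→-dec_; map′; from-yes)
open import Relation.Binary.PropositionalEquality as ≡ using (_≡_; _≢_; refl; cong; subst)
open import Function.Base using (_∘_)
open import Function.Bundles using (_⤖_; _⇔_; Bijection; Equivalence; mk⇔)
open import Function.Construct.Composition using (_⤖-∘_; _⇔-∘_)
open import Axiom.UniquenessOfIdentityProofs using (module Decidable⇒UIP)

record Pendant {X : Set} (_~_ : Rel X 0ℓ) (x y : X) : Set where
  constructor _,_
  field
    adjacent : x ~ y
    unique   : ∀ z → x ~ z → z ≡ y

record PendantPath {X : Set} (_~_ : Rel X 0ℓ) : Set where
  constructor mkPendantPath
  field
    {start middle end} : X
    start-pendant      : Pendant _~_ start middle
    middle~end         : middle ~ end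
    start≢end          : start ≢ end

RelIso : {X Y : Set} → Rel X 0ℓ → Rel Y 0ℓ → Set
RelIso {X} {Y} R S = Σ (X ⤖ Y) λ f →
  ∀ x y → R x y ⇔ S (Bijection.to f x) (Bijection.to f y)

RelIso-trans : {X Y Z : Set} {R : Rel X 0ℓ} {S : Rel Y 0ℓ} {T : Rel Z 0ℓ} →
               RelIso R S → RelIso S T → RelIso R T
RelIso-trans (f , f-hom) (g , g-hom) = g ⤖-∘ f , λ x y → g-hom _ _ ⇔-∘ f-hom x y

module RelIsoProperties {X Y : Set} {R : Rel X 0ℓ} {S : Rel Y 0ℓ} (iso : RelIso R S) where

  open Bijection (proj₁ iso) public using (to; injective; strictlySurjective)

  preserves : ∀ {x y} → R x y → S (to x) (to y)
  preserves = Equivalence.to (proj₂ iso _ _)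

  reflects : ∀ {x y} → S (to x) (to y) → R x y
  reflects = Equivalence.from (proj₂ iso _ _)

  ≢-preserved : ∀ {x y} → x ≢ y → to x ≢ to y
  ≢-preserved x≢y e = x≢y (injective e)

  ∃-preimage : {P : Y → Set} → ∃ P → ∃ λ x → P (to x)
  ∃-preimage {P} (j , pj) =
    let (x , tx≡j) = strictlySurjective j in x , subst P (≡.sym tx≡j) pj

  Pendant-preserved : ∀ {x y} → Pendant R x y ⇔ Pendant S (to x) (to y)
  Pendant-preserved = mk⇔ forth back
    where
    forth : ∀ {x y} → Pendant R x y → Pendant S (to x) (to y)
    forth {x} {y} (xy , only) = preserves xy , λ j →
      let (z , tz≡j) = strictlySurjective j
      in subst (λ j → S (to x) j → j ≡ to y) tz≡j (cong to ∘ only z ∘ reflects)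
    back : ∀ {x y} → Pendant S (to x) (to y) → Pendant R x y
    back (xy , only) = reflects xy , λ z xz → injective (only (to z) (preserves xz))

module P₄ where

  _~_ : Rel (Fin 4) 0ℓ
  _~_ = Adj (P 4)

  _~?_ : Decidable _~_
  i ~? j = adj (P 4) i j ≟ᵇ true

  pendant? : Decidable (Pendant _~_)
  pendant? i j = map′ (λ (ij , only) → ij , only) (λ (ij , only) → ij , only)
    ((i ~? j) ×-dec all? λ k → (i ~? k) →-dec (k ≟ᶠ j))

  ∃-pendant-path : ∃[ i ] ∃[ j ] ∃[ k ] Pendant _~_ i j × j ~ k × i ≢ k
  ∃-pendant-path = from-yes
    (any? λ i → any? λ j → any? λ k → pendant? i j ×-dec (j ~? k) ×-dec ¬? (i ≟ᶠ k))

  pendant-neighbour-branches : ∀ i j → Pendant _~_ i j → ∃[ k ] j ~ k × k ≢ i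
  pendant-neighbour-branches = from-yes
    (all? λ i → all? λ j → pendant? i j →-dec any? λ k → (j ~? k) ×-dec ¬? (k ≟ᶠ i))

  path-end-pendant : ∀ i j k l → i ~ j → j ~ k → k ~ l → i ≢ k → j ≢ l → Pendant _~_ i j
  path-end-pendant = from-yes
    (all? λ i → all? λ j → all? λ k → all? λ l →
      (i ~? j) →-dec (j ~? k) →-dec (k ~? l) →-dec ¬? (i ≟ᶠ k) →-dec ¬? (j ≟ᶠ l) →-dec
      pendant? i j)

IsP₄ : {X : Set} → Rel X 0ℓ → Set
IsP₄ R = RelIso R (Adj (P 4))

module IsP₄ {X : Set} {R : Rel X 0ℓ} (iso : IsP₄ R) where

  open RelIsoProperties {S = P₄._~_} iso

  pendant-path : PendantPath R
  pendant-path with ∃-preimage P₄.∃-pendant-path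
  ... | a , a-starts with ∃-preimage a-starts
  ... | b , ab-start with ∃-preimage ab-start
  ... | c , a-pendant , bc , a≢c =
    mkPendantPath (Equivalence.from Pendant-preserved a-pendant) (reflects bc)
                  (λ e → a≢c (cong to e))

  pendant-neighbour-branches : ∀ {x y} → Pendant R x y → ∃[ z ] R y z × z ≢ x
  pendant-neighbour-branches {x} {y} x-pendant
    with ∃-preimage (P₄.pendant-neighbour-branches (to x) (to y)
                       (Equivalence.to Pendant-preserved x-pendant))
  ... | z , yz , z≢x = z , reflects yz , λ e → z≢x (cong to e)

  no-isolated-edge : ∀ {x y} → Pendant R x y → Pendant R y x → ⊥
  no-isolated-edge x-pendant (_ , only-x) =
    let (z , yz , z≢x) = pendant-neighbour-branches x-pendant in z≢x (only-x z yz)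

  path-end-pendant : ∀ {w x y z} → R w x → R x y → R y z → w ≢ y → x ≢ z → Pendant R w x
  path-end-pendant wx xy yz w≢y x≢z = Equivalence.from Pendant-preserved
    (P₄.path-end-pendant _ _ _ _ (preserves wx) (preserves xy) (preserves yz)
                                 (≢-preserved w≢y) (≢-preserved x≢z))

Induced : ∀ {n} (G : Graph n) (u v : Fin n) → Rel (Common G u v) 0ℓ
Induced G u v x y = Adj G (proj₁ x) (proj₁ y)

module _ {n : ℕ} (G : Graph n) where

  OnlyCommonNeighbour : (x y z t : Fin n) → Set
  OnlyCommonNeighbour x y z t = ∀ w → Adj G x w → Adj G y w → Adj G z w → w ≡ t

  Adj-sym : ∀ {u v} → Adj G u v → Adj G v u
  Adj-sym {u} {v} uv = ≡.trans (sym G v u) uv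

  Adj-irrelevant : ∀ {u v} (p q : Adj G u v) → p ≡ q
  Adj-irrelevant = Decidable⇒UIP.≡-irrelevant _≟ᵇ_

  Common-≡ : ∀ {u v} {x y : Common G u v} → proj₁ x ≡ proj₁ y → x ≡ y
  Common-≡ {x = w , ux , vx} {y = .w , uy , vy} refl
    rewrite Adj-irrelevant ux uy | Adj-irrelevant vx vy = refl

  PendantPath-swap : ∀ {u v} → PendantPath (Induced G u v) → PendantPath (Induced G v u)
  PendantPath-swap (mkPendantPath (ab , only-b) bc a≢c) =
    mkPendantPath (ab , λ z az → cong (map₂ swap) (only-b (map₂ swap z) az)) bc
                  (λ e → a≢c (cong (map₂ swap) e))

  Pendant⇒OnlyCommonNeighbour : ∀ {u v} {x y : Common G u v} → Pendant (Induced G u v) x y →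
                                OnlyCommonNeighbour u v (proj₁ x) (proj₁ y)
  Pendant⇒OnlyCommonNeighbour (_ , only) w uw vw xw = cong proj₁ (only (w , uw , vw) xw)

  OnlyCommonNeighbour⇒Pendant : ∀ {u v} {x y : Common G u v} → Induced G u v x y →
                                OnlyCommonNeighbour u v (proj₁ x) (proj₁ y) →
                                Pendant (Induced G u v) x y
  OnlyCommonNeighbour⇒Pendant xy only = xy , λ (w , uw , vw) xw → Common-≡ (only w uw vw xw)

  UniformSNS-resp-Iso : ∀ {m} {H K : Graph m} → UniformSNS G H → Iso H K → UniformSNS G K
  UniformSNS-resp-Iso {H = H} {K} sns H≅K u v uv =
    RelIso-trans {S = Adj H} {T = Adj K} (sns u v uv) H≅K

  module _ (uniform : UniformSNS G (P 4)) where

    p₄ : ∀ {u v} → Adj G u v → IsP₄ (Induced G u v)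
    p₄ uv = uniform _ _ uv

    pendant-path⇒OnlyCommonNeighbour :
      ∀ {u v} → Adj G u v → (π : PendantPath (Induced G u v)) →
      let open PendantPath π in OnlyCommonNeighbour (proj₁ middle) (proj₁ end) u v
    pendant-path⇒OnlyCommonNeighbour {u} {v} uv
      (mkPendantPath {a , ua , va} {b , ub , vb} {c , uc , vc} a-pendant@(ab , _) bc a≢c)
      w bw cw uw =
      let v-pendant : Pendant (Induced G u a) (v , uv , Adj-sym va) (b , ub , ab)
          v-pendant = OnlyCommonNeighbour⇒Pendant vb
            λ t ut at vt → Pendant⇒OnlyCommonNeighbour a-pendant t ut vt at
          ((y , uy , ay) , by , y≢v) = IsP₄.pendant-neighbour-branches (p₄ ua) v-pendant
          c-pendant : Pendant (Induced G u b) (c , uc , bc) (v , uv , Adj-sym vb)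
          c-pendant = IsP₄.path-end-pendant (p₄ ub) {y = a , ua , Adj-sym ab} {z = y , uy , by}
            (Adj-sym vc) va ay
            (λ c≡a → a≢c (Common-≡ (≡.sym (cong proj₁ c≡a))))
            (λ v≡y → y≢v (Common-≡ (≡.sym (cong proj₁ v≡y))))
      in Pendant⇒OnlyCommonNeighbour c-pendant w uw bw cw

    no-edge : ∀ {u v} → Adj G u v → ⊥
    no-edge {u} {v} uv with IsP₄.pendant-path (p₄ uv)
    ... | π@(mkPendantPath {_} {b , ub , vb} {c , uc , vc} _ bc _) =
      IsP₄.no-isolated-edge (p₄ bc)
        {x = u , Adj-sym ub , Adj-sym uc} {y = v , Adj-sym vb , Adj-sym vc}
        (OnlyCommonNeighbour⇒Pendant uv (pendant-path⇒OnlyCommonNeighbour uv π))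
        (OnlyCommonNeighbour⇒Pendant (Adj-sym uv)
          (pendant-path⇒OnlyCommonNeighbour (Adj-sym uv) (PendantPath-swap π)))

theorem3 : (n d : ℕ) (G : Graph n) → ER n d 4 G →
    (edge : Σ (Fin n) λ u → Σ (Fin n) λ v → Adj G u v) →
    (H : Graph 4) → UniformSNS G H → ¬ Iso H (P 4)
theorem3 _ _ G _ (_ , _ , uv) H sns H≅P₄ =
  no-edge G (UniformSNS-resp-Iso G {H = H} {K = P 4} sns H≅P₄) uv
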